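{- Let $G=(V,E)$ be a graph, $\pi$ an ordering of $V$, $V^?\subseteq V$ and $E^?\subseteq E$. Let $S=F(G,V^?,E^?,1)$ be the output of the procedure $F$ (InfluenceMIS) described in the context. Then for every vertex $o$ for which there exists $X\subseteq V^?\cup E^?$ with $o\in M(G)\,\triangle\,M(G\setminus X)$, we have $o\in S$. That is, InfluenceMIS conservatively solves the influence analysis problem for LFMIS with respect to $\pi$.
   Context: $M(H)$ is the lexicographically first MIS of $H$ with respect to $\pi$ (scan in $\pi$-order, add a vertex iff no neighbor already added). For $X\subseteq V^?\cup E^?$, $G\setminus X$ is obtained from $G$ by deleting the vertices in $X$ together with their incident edges and deleting the edges in $X$. Procedure $F(G,V^?,E^?,i)$, where $G=(V,E)$ is the current graph, $V^?\subseteq V$ the undecided vertices and $E^?\subseteq E$ the undecided edges: (1) if $V^?=\emptyset$ and $E^?=\emptyset$, return $\emptyset$. (2) Let $u=\pi(i)$ (the $i$-th vertex in the ordering). If $u\notin V$ (current vertex set), return $F(G,V^?,E^?,i+1)$. (3) If $u\in V^?$: add every current neighbor of $u$ to $V^?$; delete $u$ from $G$, $V^?$, $E^?$; return $\{u\}\cup F(G,V^?,E^?,i+1)$. (4) Otherwise, for each current neighbor $v$ of $u$: if $(u,v)\in E^?$, add $v$ to $V^?$; else delete $v$ from $G$, $V^?$, $E^?$. Then delete $u$ from $G,V^?,E^?$ and return $F(G,V^?,E^?,i+1)$. Deleting a vertex from $G$ removes it and its incident edges; deleting it from $E^?$ removes all undecided edges incident to it. -}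

module Defs where

open import Data.Nat using (ℕ)
open import Data.Fin using (Fin; _≟_)
open import Data.Fin.Permutation using (Permutation′; _⟨$⟩ʳ_)
open import Data.Bool using (Bool; true; false; _∧_; _∨_; not; if_then_else_)
open import Data.List using (List; []; _∷_; map)
open import Data.Bool.ListAction using (any; all)
open import Data.List using () renaming (allFin to allFinL)
open import Relation.Nullary.Decidable using (⌊_⌋)

-- Vertex set of the input graph G is Fin n.  Subsets of vertices are
-- Boolean predicates; edge sets are Boolean relations (an undirected edge
-- {u,v} is present iff the relation holds at (u,v), symmetric by hypothesis).
VSet : ℕ → Set
VSet n = Fin n → Bool

ESet : ℕ → Set
ESet n = Fin n → Fin n → Bool

module _ {n : ℕ} where

  ∅ : VSet n
  ∅ _ = false

  order : Permutation′ n → List (Fin n)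
  order π = map (π ⟨$⟩ʳ_) (allFinL n)

  isEq : Fin n → Fin n → Bool
  isEq a b = ⌊ a ≟ b ⌋

  lfmisScan : VSet n → ESet n → List (Fin n) → VSet n → VSet n
  lfmisScan Vs Es [] S = S
  lfmisScan Vs Es (u ∷ us) S =
    if Vs u ∧ not (any (λ w → S w ∧ Es u w) (allFinL n))
    then lfmisScan Vs Es us (λ w → S w ∨ isEq w u)
    else lfmisScan Vs Es us S

  M : Permutation′ n → VSet n → ESet n → VSet n
  M π Vs Es = lfmisScan Vs Es (order π) ∅

  -- G \ X for G = (Fin n, adj), X = XV ∪ XE
  delV : VSet n → VSet n
  delV XV v = not (XV v)

  delE : ESet n → VSet n → ESet n → ESet n
  delE adj XV XE a b = adj a b ∧ not (XE a b) ∧ not (XV a) ∧ not (XV b)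

  record State : Set where
    constructor st
    field
      curV : VSet n
      curE : ESet n
      undV : VSet n
      undE : ESet n
  open State public

  deleteVs : VSet n → State → State
  deleteVs D (st V E Vq Eq) =
    st (λ w → V w ∧ not (D w))
       (λ a b → E a b ∧ not (D a) ∧ not (D b))
       (λ w → Vq w ∧ not (D w))
       (λ a b → Eq a b ∧ not (D a) ∧ not (D b))

  addUndV : VSet n → State → State
  addUndV A (st V E Vq Eq) = st V E (λ w → Vq w ∨ A w) Eq

  bothEmpty : State → Bool
  bothEmpty s = all (λ v → not (undV s v)) (allFinL n)
              ∧ all (λ a → all (λ b → not (undE s a b)) (allFinL n)) (allFinL n)

  nbr : State → Fin n → VSet n
  nbr s u v = curV s u ∧ curV s v ∧ curE s u v

  -- F processes the vertices π(i), π(i+1), ... given as a list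
  F : List (Fin n) → State → VSet n
  F [] s = ∅
  F (u ∷ us) s =
    if bothEmpty s then ∅
    else if not (curV s u) then F us s
    else if undV s u
      then (λ w → isEq w u ∨
              F us (deleteVs (isEq u) (addUndV (nbr s u) s)) w)
      else F us (deleteVs (isEq u)
                   (deleteVs (λ v → nbr s u v ∧ not (undE s u v))
                     (addUndV (λ v → nbr s u v ∧ undE s u v) s)))

  InfluenceMIS : Permutation′ n → ESet n → VSet n → ESet n → VSet n
  InfluenceMIS π adj Vq Eq = F (order π) (st (λ _ → true) adj Vq Eq)

-- Run the LFMIS scan on G ∖ X for all admissible X ⊆ V? ∪ E? at once.  Once the scan has
-- passed a vertex u, what it still has to decide for G ∖ X is the current graph of F with some
-- admissible X′ deleted, where X′ consists of vertices and edges that F has marked undecided: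
-- if u is undecided, whether it entered the MIS depends on X, so all its neighbours become
-- undecided; if u is decided, it enters every MIS, its neighbours along decided edges disappear
-- in every G ∖ X and those along undecided edges become undecided.  Hence the scans of any two
-- admissible deletions, in particular of ∅ and of X, differ at u only if u is undecided, and
-- then F outputs u.  When V? and E? are empty only the empty deletion is admissible.
module Submission where

open import Defs
open import Data.Nat using (ℕ)
open import Data.Fin using (Fin; _≟_)
open import Data.Fin.Permutation using (Permutation′)
open import Data.Bool using (Bool; true; false; _∧_; _∨_; not; if_then_else_; _xor_)
open import Data.Bool.Properties
  using (∨-zeroʳ; ∨-identityʳ; ∨-assoc; ∧-identityʳ; ∧-zeroʳ; ∧-comm; ∧-distribʳ-∨;
         ∨-conicalˡ; ∨-conicalʳ; ∨-commutativeMonoid; ¬-not; xor-same; if-float)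
open import Data.Bool.ListAction using (any; all)
open import Data.List using (List; []; _∷_) renaming (allFin to allFinL)
open import Data.List.Membership.Propositional using (_∈_)
open import Data.List.Membership.Propositional.Properties using (∈-allFin)
open import Data.List.Relation.Unary.Any using (here; there)
open import Data.Product using (_×_; _,_; proj₁; proj₂; Σ-syntax)
open import Data.Sum using (_⊎_; inj₁; inj₂; [_,_])
open import Relation.Binary.PropositionalEquality
  using (_≡_; _≢_; refl; sym; trans; cong; cong₂; cong-app; subst; _≗_; module ≡-Reasoning)
open import Relation.Nullary using (yes; no; contradiction)
open import Algebra.Bundles using (CommutativeMonoid)
open import Algebra.Properties.CommutativeSemigroup
  (CommutativeMonoid.commutativeSemigroup ∨-commutativeMonoid) using (interchange)

not≡true : ∀ {b} → not b ≡ true → b ≡ false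
not≡true {false} _ = refl

∧-intro : ∀ {x y} → x ≡ true → y ≡ true → x ∧ y ≡ true
∧-intro refl refl = refl

∧≡true : ∀ {x y} → x ∧ y ≡ true → x ≡ true × y ≡ true
∧≡true {true} {true} _ = refl , refl

∧-not≡true : ∀ {x y} → x ∧ not y ≡ true → x ≡ true × y ≡ false
∧-not≡true {true} {false} _ = refl , refl

∧-not≡false : ∀ {x y} → x ∧ not y ≡ false → x ≡ false ⊎ y ≡ true
∧-not≡false {false}        _ = inj₁ refl
∧-not≡false {true} {true}  _ = inj₂ refl

∧-not-not≡true : ∀ {x y z} → x ∧ not y ∧ not z ≡ true → x ≡ true × y ≡ false × z ≡ false
∧-not-not≡true {true} {false} {false} _ = refl , refl , refl

∧-not-not≡false : ∀ {x y z} → x ∧ not y ∧ not z ≡ false → x ≡ false ⊎ y ≡ true ⊎ z ≡ true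
∧-not-not≡false {false}               _ = inj₁ refl
∧-not-not≡false {true} {true}         _ = inj₂ (inj₁ refl)
∧-not-not≡false {true} {false} {true} _ = inj₂ (inj₂ refl)

∧-not³≡false : ∀ {e x y z} → e ≡ true → y ≡ false → z ≡ false
             → e ∧ not x ∧ not y ∧ not z ≡ false → x ≡ true
∧-not³≡false {x = true}  _    _    _    _  = refl
∧-not³≡false {x = false} refl refl refl ()

∧-not-excluded : ∀ {x y} → x ≡ true → x ∧ not y ≡ false → y ≡ true
∧-not-excluded {y = true}  _    _  = refl
∧-not-excluded {y = false} refl ()

⇒-false : ∀ {x y} → (x ≡ true → y ≡ true) → y ≡ false → x ≡ false
⇒-false {false} _   _       = refl
⇒-false {true}  x⇒y y≡false = trans (sym (x⇒y refl)) y≡false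

⇒-∧-not : ∀ {x y} → (x ≡ true → y ≡ true) → x ∧ not y ≡ false
⇒-∧-not {false} _   = refl
⇒-∧-not {true}  x⇒y rewrite x⇒y refl = refl

∧-same-false : ∀ x y {i} → i ≡ false → x ∧ i ≡ y ∧ i
∧-same-false x y refl = trans (∧-zeroʳ x) (sym (∧-zeroʳ y))

∨≡true : ∀ {x y} → x ∨ y ≡ true → x ≡ true ⊎ y ≡ true
∨≡true {true}  _ = inj₁ refl
∨≡true {false} y = inj₂ y

module _ {A : Set} where

  any-∈ : {p : A → Bool} {x : A} {xs : List A} → x ∈ xs → p x ≡ true → any p xs ≡ true
  any-∈ (here refl) px rewrite px = refl
  any-∈ {p} {xs = y ∷ _} (there x∈xs) px =
    trans (cong (p y ∨_) (any-∈ x∈xs px)) (∨-zeroʳ (p y))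

  any-false : {p : A → Bool} → (∀ x → p x ≡ false) → (xs : List A) → any p xs ≡ false
  any-false p≡false []       = refl
  any-false p≡false (x ∷ xs) rewrite p≡false x = any-false p≡false xs

  any-cong : {p q : A → Bool} → p ≗ q → (xs : List A) → any p xs ≡ any q xs
  any-cong p≗q []       = refl
  any-cong p≗q (x ∷ xs) = cong₂ _∨_ (p≗q x) (any-cong p≗q xs)

  any-∨ : (p q : A → Bool) (xs : List A) → any (λ x → p x ∨ q x) xs ≡ any p xs ∨ any q xs
  any-∨ p q []       = refl
  any-∨ p q (x ∷ xs) =
    trans (cong ((p x ∨ q x) ∨_) (any-∨ p q xs)) (interchange (p x) (q x) (any p xs) (any q xs))

  all-∈ : {p : A → Bool} {x : A} {xs : List A} → x ∈ xs → all p xs ≡ true → p x ≡ true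
  all-∈ {p} (here refl) all≡true = proj₁ (∧≡true {p _} all≡true)
  all-∈ {p} {xs = y ∷ _} (there x∈xs) all≡true = all-∈ x∈xs (proj₂ (∧≡true {p y} all≡true))

module _ {n : ℕ} where

  isEq-refl : (u : Fin n) → isEq u u ≡ true
  isEq-refl u with u ≟ u
  ... | yes _  = refl
  ... | no u≢u = contradiction refl u≢u

  isEq⇒≡ : {u v : Fin n} → isEq u v ≡ true → u ≡ v
  isEq⇒≡ {u} {v} _ with u ≟ v
  ... | yes u≡v = u≡v

  isEq-sym : (u v : Fin n) → isEq u v ≡ isEq v u
  isEq-sym u v with u ≟ v | v ≟ u
  ... | yes _   | yes _   = refl
  ... | no  _   | no  _   = refl
  ... | yes u≡v | no  v≢u = contradiction (sym u≡v) v≢u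
  ... | no  u≢v | yes v≡u = contradiction (sym v≡u) u≢v

  infixr 5 _∪_
  infix  4 _⊆_ _≈_ _⊑_

  _∪_ : VSet n → VSet n → VSet n
  (S ∪ R) w = S w ∨ R w

  ⁅_⁆ : Fin n → VSet n
  ⁅ u ⁆ w = isEq w u

  _⊆_ : VSet n → VSet n → Set
  A ⊆ B = ∀ {w} → A w ≡ true → B w ≡ true

  record Graph : Set where
    constructor graph
    field
      vertices : VSet n
      edges    : ESet n
  open Graph public

  blocked : ESet n → VSet n → Fin n → Bool
  blocked Es S u = any (λ w → S w ∧ Es u w) (allFinL n)

  blocked-∅ : (Es : ESet n) (u : Fin n) → blocked Es ∅ u ≡ false
  blocked-∅ Es u = any-false (λ _ → refl) (allFinL n)

  blocked-⁅⁆ : (Es : ESet n) (u v : Fin n) → blocked Es ⁅ v ⁆ u ≡ Es u v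
  blocked-⁅⁆ Es u v with Es u v in uv
  ... | true  = any-∈ (∈-allFin v) (trans (cong (_∧ Es u v) (isEq-refl v)) uv)
  ... | false = any-false only-v (allFinL n)
    where
      only-v : ∀ w → isEq w v ∧ Es u w ≡ false
      only-v w with isEq w v in wv
      ... | false = refl
      ... | true  rewrite isEq⇒≡ wv = uv

  blocked-∪ : (Es : ESet n) {L S R : VSet n} → L ≗ S ∪ R → (u : Fin n)
            → blocked Es L u ≡ blocked Es S u ∨ blocked Es R u
  blocked-∪ Es {L} {S} {R} L≗S∪R u = trans (any-cong distrib (allFinL n))
    (any-∨ (λ w → S w ∧ Es u w) (λ w → R w ∧ Es u w) (allFinL n))
    where
      distrib : ∀ w → L w ∧ Es u w ≡ (S w ∧ Es u w) ∨ (R w ∧ Es u w)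
      distrib w = trans (cong (_∧ Es u w) (L≗S∪R w)) (∧-distribʳ-∨ (Es u w) (S w) (R w))

  blocked-cong : (Es Es′ : ESet n) {R : VSet n} (u : Fin n)
               → (∀ {x} → R x ≡ true → Es u x ≡ Es′ u x) → blocked Es R u ≡ blocked Es′ R u
  blocked-cong Es Es′ {R} u agree = any-cong agreeOnR (allFinL n)
    where
      agreeOnR : ∀ x → R x ∧ Es u x ≡ R x ∧ Es′ u x
      agreeOnR x with R x in Rx
      ... | false = refl
      ... | true  = agree Rx

  scan : Graph → List (Fin n) → VSet n → VSet n
  scan g = lfmisScan (vertices g) (edges g)

  lfmis : List (Fin n) → Graph → VSet n
  lfmis us g = scan g us ∅

  canAdd : Graph → VSet n → Fin n → Bool
  canAdd g S u = vertices g u ∧ not (blocked (edges g) S u)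

  scanStep : Graph → VSet n → Fin n → VSet n
  scanStep g S u = if canAdd g S u then S ∪ ⁅ u ⁆ else S

  scan-∷ : (g : Graph) (u : Fin n) (us : List (Fin n)) (S : VSet n)
         → scan g (u ∷ us) S ≡ scan g us (scanStep g S u)
  scan-∷ g u us S = sym (if-float (scan g us) (canAdd g S u))

  scanStep-⊆ : (h : Graph) {R : VSet n} → R ⊆ vertices h → ∀ u → scanStep h R u ⊆ vertices h
  scanStep-⊆ h {R} R⊆h u {w} w∈ with canAdd h R u in added
  ... | false = R⊆h w∈
  ... | true  = [ R⊆h , (λ w≡u → subst (λ x → vertices h x ≡ true) (sym (isEq⇒≡ w≡u)) u∈h) ]
                  (∨≡true w∈)
    where
      u∈h : vertices h u ≡ true
      u∈h = proj₁ (∧≡true added)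

  record Remainder (S : VSet n) (g h : Graph) : Set where
    field
      vertices-≡ : ∀ w → vertices h w ≡ vertices g w ∧ not (S w) ∧ not (blocked (edges g) S w)
      edges-≡    : ∀ {a b} → vertices h a ≡ true → vertices h b ≡ true → edges g a b ≡ edges h a b

  module _ {S : VSet n} {g h : Graph} (rem : Remainder S g h)
           {L R : VSet n} (L≗S∪R : L ≗ S ∪ R) (R⊆h : R ⊆ vertices h) where
    open Remainder rem

    canAdd-remainder : ∀ {u} → vertices h u ≡ true → canAdd g L u ≡ canAdd h R u
    canAdd-remainder {u} u∈h = begin
      vertices g u ∧ not (blocked (edges g) L u)
        ≡⟨ cong (λ b → vertices g u ∧ not b) (blocked-∪ (edges g) L≗S∪R u) ⟩
      vertices g u ∧ not (blocked (edges g) S u ∨ blocked (edges g) R u)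
        ≡⟨ cong₂ (λ a b → a ∧ not (b ∨ blocked (edges g) R u)) u∈g u∉N[S] ⟩
      not (blocked (edges g) R u)
        ≡⟨ cong not (blocked-cong (edges g) (edges h) u (λ x∈R → edges-≡ u∈h (R⊆h x∈R))) ⟩
      not (blocked (edges h) R u)
        ≡⟨ cong (_∧ not (blocked (edges h) R u)) u∈h ⟨
      vertices h u ∧ not (blocked (edges h) R u) ∎
      where
        open ≡-Reasoning
        survives : vertices g u ≡ true × S u ≡ false × blocked (edges g) S u ≡ false
        survives = ∧-not-not≡true (trans (sym (vertices-≡ u)) u∈h)
        u∈g : vertices g u ≡ true
        u∈g = proj₁ survives
        u∉N[S] : blocked (edges g) S u ≡ false
        u∉N[S] = proj₂ (proj₂ survives)

    canAdd-only-g : ∀ {u} → canAdd h R u ≡ false → canAdd g L u ≡ true → S u ≡ true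
    canAdd-only-g {u} rejected added = removedByS u∈g u∉N[S] (trans (sym (vertices-≡ u)) u∉h)
      where
        u∉h : vertices h u ≡ false
        u∉h = ¬-not λ u∈h →
          contradiction (trans (sym added) (trans (canAdd-remainder u∈h) rejected)) λ ()
        u∈g : vertices g u ≡ true
        u∈g = proj₁ (∧-not≡true added)
        u∉N[S] : blocked (edges g) S u ≡ false
        u∉N[S] = ∨-conicalˡ _ _
          (trans (sym (blocked-∪ (edges g) L≗S∪R u)) (proj₂ (∧-not≡true added)))
        removedByS : ∀ {v s b} → v ≡ true → b ≡ false → v ∧ not s ∧ not b ≡ false → s ≡ true
        removedByS {s = true}  _    _    _  = refl
        removedByS {s = false} refl refl ()

    scanStep-remainder : ∀ u → scanStep g L u ≗ S ∪ scanStep h R u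
    scanStep-remainder u w with canAdd h R u in addedH | canAdd g L u in addedG
    ... | true  | true  = trans (cong (_∨ isEq w u) (L≗S∪R w)) (∨-assoc (S w) (R w) (isEq w u))
    ... | false | false = L≗S∪R w
    ... | true  | false = contradiction
      (trans (sym addedG) (trans (canAdd-remainder (proj₁ (∧≡true addedH))) addedH)) λ ()
    ... | false | true with isEq w u in w≡u
    ...   | false = trans (∨-identityʳ (L w)) (L≗S∪R w)
    ...   | true rewrite isEq⇒≡ w≡u | canAdd-only-g addedH addedG = ∨-zeroʳ (L u)

  scan-remainder : {S : VSet n} {g h : Graph} → Remainder S g h → (us : List (Fin n))
                 → {L R : VSet n} → L ≗ S ∪ R → R ⊆ vertices h → scan g us L ≗ S ∪ scan h us R
  scan-remainder rem []       L≗S∪R R⊆h = L≗S∪R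
  scan-remainder {S} {g} {h} rem (u ∷ us) {L} {R} L≗S∪R R⊆h w = begin
    scan g (u ∷ us) L w
      ≡⟨ cong-app (scan-∷ g u us L) w ⟩
    scan g us (scanStep g L u) w
      ≡⟨ scan-remainder rem us (scanStep-remainder rem L≗S∪R R⊆h u) (scanStep-⊆ h R⊆h u) w ⟩
    S w ∨ scan h us (scanStep h R u) w
      ≡⟨ cong (S w ∨_) (cong-app (scan-∷ h u us R) w) ⟨
    S w ∨ scan h (u ∷ us) R w ∎
    where open ≡-Reasoning

  record _≈_ (g h : Graph) : Set where
    field
      vertices-≗ : vertices g ≗ vertices h
      edges-≡    : ∀ {a b} → vertices h a ≡ true → vertices h b ≡ true → edges g a b ≡ edges h a b

  ≈⇒remainder-∅ : {g h : Graph} → g ≈ h → Remainder ∅ g h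
  ≈⇒remainder-∅ {g} {h} g≈h = record { vertices-≡ = same-vertex ; edges-≡ = edges-≡ }
    where
      open _≈_ g≈h
      same-vertex : ∀ w → vertices h w ≡ vertices g w ∧ not (blocked (edges g) ∅ w)
      same-vertex w = sym (begin
        vertices g w ∧ not (blocked (edges g) ∅ w)
          ≡⟨ cong (λ b → vertices g w ∧ not b) (blocked-∅ (edges g) w) ⟩
        vertices g w ∧ true ≡⟨ ∧-identityʳ (vertices g w) ⟩
        vertices g w        ≡⟨ vertices-≗ w ⟩
        vertices h w        ∎)
        where open ≡-Reasoning

  lfmis-cong : {g h : Graph} → g ≈ h → (us : List (Fin n)) → lfmis us g ≗ lfmis us h
  lfmis-cong g≈h us = scan-remainder (≈⇒remainder-∅ g≈h) us (λ _ → refl) λ ()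

  -- What the scan still has to decide after processing u as its first vertex: u itself and,
  -- if u was present (and so joined the MIS), its neighbours are gone.
  residual : Graph → Fin n → Graph
  residual g u =
    graph (λ w → vertices g w ∧ not (isEq w u) ∧ not (vertices g u ∧ edges g w u)) (edges g)

  residual-absent : (g : Graph) {u : Fin n} → vertices g u ≡ false → g ≈ residual g u
  residual-absent g {u} u∉g = record { vertices-≗ = unchanged ; edges-≡ = λ _ _ → refl }
    where
      unchanged : ∀ w → vertices g w ≡ vertices g w ∧ not (isEq w u) ∧ not (vertices g u ∧ edges g w u)
      unchanged w rewrite u∉g with isEq w u in w≡u
      ... | false = sym (∧-identityʳ (vertices g w))
      ... | true  rewrite isEq⇒≡ w≡u | u∉g = refl

  residual-present : (g : Graph) {u : Fin n} → vertices g u ≡ true → Remainder ⁅ u ⁆ g (residual g u)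
  residual-present g {u} u∈g = record { vertices-≡ = N[u]-removed ; edges-≡ = λ _ _ → refl }
    where
      N[u]-removed : ∀ w → vertices (residual g u) w
                         ≡ vertices g w ∧ not (isEq w u) ∧ not (blocked (edges g) ⁅ u ⁆ w)
      N[u]-removed w rewrite u∈g | blocked-⁅⁆ (edges g) w u = refl

  residual-vertex : (g : Graph) (u : Fin n) {w : Fin n} → vertices (residual g u) w ≡ true
                  → vertices g w ≡ true × isEq w u ≡ false × vertices g u ∧ edges g w u ≡ false
  residual-vertex g u = ∧-not-not≡true

  canAdd-∅ : (g : Graph) (u : Fin n) → canAdd g ∅ u ≡ vertices g u
  canAdd-∅ g u =
    trans (cong (λ b → vertices g u ∧ not b) (blocked-∅ (edges g) u)) (∧-identityʳ (vertices g u))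

  lfmis-∷ : (g : Graph) (u : Fin n) (us : List (Fin n))
          → ∀ w → lfmis (u ∷ us) g w ≡ (vertices g u ∧ isEq w u) ∨ lfmis us (residual g u) w
  lfmis-∷ g u us w = begin
    lfmis (u ∷ us) g w                            ≡⟨ cong-app (scan-∷ g u us ∅) w ⟩
    scan g us (scanStep g ∅ u) w                  ≡⟨ cong (λ b → scan g us (if b then ⁅ u ⁆ else ∅) w)
                                                          (canAdd-∅ g u) ⟩
    scan g us (if vertices g u then ⁅ u ⁆ else ∅) w ≡⟨ byMembership (vertices g u) refl ⟩
    (vertices g u ∧ isEq w u) ∨ lfmis us (residual g u) w ∎
    where
      open ≡-Reasoning
      -- Splitting with `with` would also rewrite vertices g u inside the unfolded residual.
      byMembership : (b : Bool) → vertices g u ≡ b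
                   → scan g us (if b then ⁅ u ⁆ else ∅) w ≡ (b ∧ isEq w u) ∨ lfmis us (residual g u) w
      byMembership true  u∈g =
        scan-remainder (residual-present g u∈g) us (λ v → sym (∨-identityʳ (isEq v u))) (λ ()) w
      byMembership false u∉g = lfmis-cong (residual-absent g u∉g) us w

  graphOf : State → Graph
  graphOf s = graph (curV s) (curE s)

  _∖[_,_] : Graph → VSet n → ESet n → Graph
  g ∖[ XV , XE ] = graph (λ w → vertices g w ∧ not (XV w)) (delE (edges g) XV XE)

  ∖-trivial : (g : Graph) {XV : VSet n} {XE : ESet n}
            → (∀ v → XV v ≡ false) → (∀ a b → XE a b ≡ false) → g ∖[ XV , XE ] ≈ g
  ∖-trivial g {XV} {XE} noXV noXE = record
    { vertices-≗ = λ w → trans (cong (λ x → vertices g w ∧ not x) (noXV w)) (∧-identityʳ (vertices g w))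
    ; edges-≡    = λ {a} {b} _ _ → unchanged a b }
    where
      unchanged : ∀ a b → delE (edges g) XV XE a b ≡ edges g a b
      unchanged a b rewrite noXE a b | noXV a | noXV b = ∧-identityʳ (edges g a b)

  record Admissible (s : State) (XV : VSet n) (XE : ESet n) : Set where
    field
      XV⊆undV : XV ⊆ undV s
      XE⊆undE : ∀ {a b} → XE a b ≡ true → undE s a b ≡ true

  bothEmpty-∖ : {s : State} {XV : VSet n} {XE : ESet n}
              → bothEmpty s ≡ true → Admissible s XV XE → graphOf s ∖[ XV , XE ] ≈ graphOf s
  bothEmpty-∖ {s} done adm = ∖-trivial (graphOf s)
    (λ v → ⇒-false XV⊆undV (not≡true (all-∈ (∈-allFin v) noUndV)))
    (λ a b → ⇒-false XE⊆undE (not≡true (all-∈ (∈-allFin b) (all-∈ (∈-allFin a) noUndE))))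
    where
      open Admissible adm
      noUndV = proj₁ (∧≡true done)
      noUndE = proj₂ (∧≡true done)

  record UndecidedOutside (s : State) (h : Graph) : Set where
    field
      vertices-⊆       : vertices h ⊆ curV s
      edges-⊆          : ∀ {a b} → vertices h a ≡ true → vertices h b ≡ true
                         → edges h a b ≡ true → curE s a b ≡ true
      vertex-undecided : ∀ {w} → curV s w ≡ true → vertices h w ≡ false → undV s w ≡ true
      edge-undecided   : ∀ {a b} → vertices h a ≡ true → vertices h b ≡ true
                         → curE s a b ≡ true → edges h a b ≡ false → undE s a b ≡ true

  undecidedOutside⇒deletion : {s : State} {h : Graph} → UndecidedOutside s h
    → Σ[ XV ∈ VSet n ] Σ[ XE ∈ ESet n ] Admissible s XV XE × h ≈ graphOf s ∖[ XV , XE ]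
  undecidedOutside⇒deletion {s} {h} out = XV , XE , admissible , h≈
    where
      open UndecidedOutside out
      XV : VSet n
      XV w = curV s w ∧ not (vertices h w)
      XE : ESet n
      XE a b = vertices h a ∧ vertices h b ∧ curE s a b ∧ not (edges h a b)

      admissible : Admissible s XV XE
      admissible = record
        { XV⊆undV = λ w∈XV → let (w∈s , w∉h) = ∧-not≡true w∈XV in vertex-undecided w∈s w∉h
        ; XE⊆undE = λ ab∈XE →
            let (a∈h , rest)  = ∧≡true ab∈XE
                (b∈h , rest′) = ∧≡true rest
                (ab∈s , ab∉h) = ∧-not≡true rest′
            in edge-undecided a∈h b∈h ab∈s ab∉h }

      notInXV : ∀ {w} → vertices h w ≡ true → XV w ≡ false
      notInXV w∈h rewrite w∈h | vertices-⊆ w∈h = refl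

      same-vertex : ∀ w → vertices h w ≡ curV s w ∧ not (curV s w ∧ not (vertices h w))
      same-vertex w with vertices h w in w∈h
      ... | true  rewrite vertices-⊆ w∈h = refl
      ... | false with curV s w
      ...   | true  = refl
      ...   | false = refl

      same-edge : ∀ {a b} → vertices h a ≡ true → vertices h b ≡ true
                → edges h a b ≡ delE (curE s) XV XE a b
      same-edge {a} {b} a∈h b∈h rewrite notInXV a∈h | notInXV b∈h | a∈h | b∈h with edges h a b in ab∈h
      ... | true  rewrite edges-⊆ a∈h b∈h ab∈h = refl
      ... | false with curE s a b
      ...   | true  = refl
      ...   | false = refl

      h≈ : h ≈ graphOf s ∖[ XV , XE ]
      h≈ = record
        { vertices-≗ = same-vertex
        ; edges-≡    = λ {a} {b} a∈ b∈ →
                         same-edge (trans (same-vertex a) a∈) (trans (same-vertex b) b∈) }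

  record _⊑_ (s′ s : State) : Set where
    field
      curV-⊆    : curV s′ ⊆ curV s
      undV-kept : ∀ {w} → curV s′ w ≡ true → undV s w ≡ true → undV s′ w ≡ true
      curE-kept : ∀ {a b} → curV s′ a ≡ true → curV s′ b ≡ true → curE s′ a b ≡ curE s a b
      undE-kept : ∀ {a b} → curV s′ a ≡ true → curV s′ b ≡ true → undE s′ a b ≡ undE s a b

  ⊑-refl : {s : State} → s ⊑ s
  ⊑-refl = record { curV-⊆ = λ w∈s → w∈s ; undV-kept = λ _ w∈V? → w∈V?
                  ; curE-kept = λ _ _ → refl ; undE-kept = λ _ _ → refl }

  ⊑-trans : {s″ s′ s : State} → s″ ⊑ s′ → s′ ⊑ s → s″ ⊑ s
  ⊑-trans s″⊑s′ s′⊑s = record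
    { curV-⊆    = λ w∈s″ → P.curV-⊆ (Q.curV-⊆ w∈s″)
    ; undV-kept = λ w∈s″ w∈V? → Q.undV-kept w∈s″ (P.undV-kept (Q.curV-⊆ w∈s″) w∈V?)
    ; curE-kept = λ a∈s″ b∈s″ →
        trans (Q.curE-kept a∈s″ b∈s″) (P.curE-kept (Q.curV-⊆ a∈s″) (Q.curV-⊆ b∈s″))
    ; undE-kept = λ a∈s″ b∈s″ →
        trans (Q.undE-kept a∈s″ b∈s″) (P.undE-kept (Q.curV-⊆ a∈s″) (Q.curV-⊆ b∈s″)) }
    where
      module P = _⊑_ s′⊑s
      module Q = _⊑_ s″⊑s′

  deleteVs-⊑ : (D : VSet n) (s : State) → deleteVs D s ⊑ s
  deleteVs-⊑ D s = record
    { curV-⊆    = λ w∈s′ → proj₁ (∧-not≡true w∈s′)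
    ; undV-kept = λ w∈s′ w∈V? → ∧-intro w∈V? (cong not (kept w∈s′))
    ; curE-kept = λ a∈s′ b∈s′ → edge-kept (curE s) (kept a∈s′) (kept b∈s′)
    ; undE-kept = λ a∈s′ b∈s′ → edge-kept (undE s) (kept a∈s′) (kept b∈s′) }
    where
      kept : ∀ {w} → curV s w ∧ not (D w) ≡ true → D w ≡ false
      kept w∈s′ = proj₂ (∧-not≡true w∈s′)
      edge-kept : (Es : ESet n) {a b : Fin n} → D a ≡ false → D b ≡ false
                → Es a b ∧ not (D a) ∧ not (D b) ≡ Es a b
      edge-kept Es {a} {b} a∉D b∉D rewrite a∉D | b∉D = ∧-identityʳ (Es a b)

  deleteVs-self : (u : Fin n) (s : State) → curV (deleteVs (isEq u) s) u ≡ false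
  deleteVs-self u s = trans (cong (λ b → curV s u ∧ not b) (isEq-refl u)) (∧-zeroʳ (curV s u))

  addUndV-⊑ : (A : VSet n) (s : State) → addUndV A s ⊑ s
  addUndV-⊑ A s = record
    { curV-⊆ = λ w∈s → w∈s ; undV-kept = λ {w} _ w∈V? → cong (_∨ A w) w∈V?
    ; curE-kept = λ _ _ → refl ; undE-kept = λ _ _ → refl }

  addUndV-marks : (D A : VSet n) (s : State) {w : Fin n} → curV (deleteVs D (addUndV A s)) w ≡ true
                → A w ≡ true → undV (deleteVs D (addUndV A s)) w ≡ true
  addUndV-marks D A s {w} w∈s′ w∈A = ∧-intro (trans (cong (undV s w ∨_) w∈A) (∨-zeroʳ (undV s w)))
                                             (cong not (proj₂ (∧-not≡true w∈s′)))

  record Symmetric (s : State) : Set where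
    field
      curE-sym : ∀ (a b : Fin n) → curE s a b ≡ curE s b a
      undE-sym : ∀ (a b : Fin n) → undE s a b ≡ undE s b a

  deleteVs-symmetric : (D : VSet n) {s : State} → Symmetric s → Symmetric (deleteVs D s)
  deleteVs-symmetric D sym-s = record
    { curE-sym = λ a b → cong₂ _∧_ (curE-sym a b) (∧-comm (not (D a)) (not (D b)))
    ; undE-sym = λ a b → cong₂ _∧_ (undE-sym a b) (∧-comm (not (D a)) (not (D b))) }
    where open Symmetric sym-s

  addUndV-symmetric : (A : VSet n) {s : State} → Symmetric s → Symmetric (addUndV A s)
  addUndV-symmetric A sym-s = record { curE-sym = curE-sym ; undE-sym = undE-sym }
    where open Symmetric sym-s

  residual-undecidedOutside : {s s′ : State} {XV : VSet n} {XE : ESet n} {u : Fin n}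
    → s′ ⊑ s → Admissible s XV XE → curV s′ u ≡ false
    → vertices (residual (graphOf s ∖[ XV , XE ]) u) ⊆ curV s′
    → (∀ {w} → curV s′ w ≡ true → vertices (graphOf s ∖[ XV , XE ]) u ≡ true
              → edges (graphOf s ∖[ XV , XE ]) w u ≡ true → undV s′ w ≡ true)
    → UndecidedOutside s′ (residual (graphOf s ∖[ XV , XE ]) u)
  residual-undecidedOutside {s} {s′} {XV} {XE} {u} s′⊑s adm u∉s′ H⊆s′ neighbours-undecided = record
    { vertices-⊆       = H⊆s′
    ; edges-⊆          = λ a∈H b∈H ab∈H →
                           trans (curE-kept (H⊆s′ a∈H) (H⊆s′ b∈H)) (proj₁ (∧≡true ab∈H))
    ; vertex-undecided = vertex-undecided
    ; edge-undecided   = edge-undecided }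
    where
      open _⊑_ s′⊑s
      open Admissible adm
      G : Graph
      G = graphOf s ∖[ XV , XE ]

      ∉XV : ∀ {w} → vertices (residual G u) w ≡ true → XV w ≡ false
      ∉XV w∈H = proj₂ (∧-not≡true (proj₁ (residual-vertex G u w∈H)))

      vertex-undecided : ∀ {w} → curV s′ w ≡ true → vertices (residual G u) w ≡ false → undV s′ w ≡ true
      vertex-undecided {w} w∈s′ w∉H with ∧-not-not≡false {vertices G w} w∉H
      ... | inj₁ w∉G with ∧-not≡false {curV s w} w∉G
      ...   | inj₁ w∉s  = contradiction (trans (sym (curV-⊆ w∈s′)) w∉s) λ ()
      ...   | inj₂ w∈XV = undV-kept w∈s′ (XV⊆undV w∈XV)
      vertex-undecided {w} w∈s′ w∉H | inj₂ (inj₁ w≡u) =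
        contradiction (trans (sym w∈s′) (subst (λ x → curV s′ x ≡ false) (sym (isEq⇒≡ w≡u)) u∉s′))
                      λ ()
      vertex-undecided {w} w∈s′ w∉H | inj₂ (inj₂ adjacent) =
        let (u∈G , wu∈G) = ∧≡true {vertices G u} adjacent in neighbours-undecided w∈s′ u∈G wu∈G

      edge-undecided : ∀ {a b} → vertices (residual G u) a ≡ true → vertices (residual G u) b ≡ true
                     → curE s′ a b ≡ true → edges G a b ≡ false → undE s′ a b ≡ true
      edge-undecided a∈H b∈H ab∈s′ ab∉H = trans (undE-kept (H⊆s′ a∈H) (H⊆s′ b∈H))
        (XE⊆undE (∧-not³≡false (trans (sym (curE-kept (H⊆s′ a∈H) (H⊆s′ b∈H))) ab∈s′)
                               (∉XV a∈H) (∉XV b∈H) ab∉H))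

  visitUndecided : State → Fin n → State
  visitUndecided s u = deleteVs (isEq u) (addUndV (nbr s u) s)

  decidedNbr undecidedNbr : State → Fin n → VSet n
  decidedNbr   s u v = nbr s u v ∧ not (undE s u v)
  undecidedNbr s u v = nbr s u v ∧ undE s u v

  visitDecided : State → Fin n → State
  visitDecided s u = deleteVs (isEq u) (deleteVs (decidedNbr s u) (addUndV (undecidedNbr s u) s))

  nbr-intro : (s : State) {u w : Fin n}
            → curV s u ≡ true → curV s w ≡ true → curE s u w ≡ true → nbr s u w ≡ true
  nbr-intro s u∈s w∈s uw∈s = ∧-intro u∈s (∧-intro w∈s uw∈s)

  module _ {s : State} {XV : VSet n} {XE : ESet n} (adm : Admissible s XV XE) where
    open Admissible adm

    private
      G : Graph
      G = graphOf s ∖[ XV , XE ]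

      G-vertex : ∀ {w} → vertices G w ≡ true → curV s w ≡ true × XV w ≡ false
      G-vertex = ∧-not≡true

    step-absent : {u : Fin n} → curV s u ≡ false → UndecidedOutside s (residual G u)
    step-absent {u} u∉s = residual-undecidedOutside ⊑-refl adm u∉s
      (λ w∈H → proj₁ (G-vertex (proj₁ (residual-vertex G u w∈H))))
      (λ _ u∈G _ → contradiction (trans (sym (proj₁ (G-vertex u∈G))) u∉s) λ ())

    step-undecided : {u : Fin n} → Symmetric s → UndecidedOutside (visitUndecided s u) (residual G u)
    step-undecided {u} sym-s = residual-undecidedOutside
      (⊑-trans (deleteVs-⊑ (isEq u) _) (addUndV-⊑ (nbr s u) s)) adm
      (deleteVs-self u (addUndV (nbr s u) s)) H⊆s′ marked
      where
        open Symmetric sym-s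
        H⊆s′ : ∀ {w} → vertices (residual G u) w ≡ true → curV (visitUndecided s u) w ≡ true
        H⊆s′ {w} w∈H = ∧-intro (proj₁ (G-vertex w∈G)) (cong not (trans (isEq-sym u w) w≢u))
          where
            w∈G : vertices G w ≡ true
            w∈G = proj₁ (residual-vertex G u w∈H)
            w≢u : isEq w u ≡ false
            w≢u = proj₁ (proj₂ (residual-vertex G u w∈H))
        marked : ∀ {w} → curV (visitUndecided s u) w ≡ true → vertices G u ≡ true → edges G w u ≡ true
               → undV (visitUndecided s u) w ≡ true
        marked {w} w∈s′ u∈G wu∈G = addUndV-marks (isEq u) (nbr s u) s w∈s′
          (nbr-intro s (proj₁ (G-vertex u∈G)) (proj₁ (∧-not≡true w∈s′))
                       (trans (curE-sym u w) (proj₁ (∧≡true wu∈G))))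

    step-decided : {u : Fin n} → Symmetric s → undV s u ≡ false
                 → UndecidedOutside (visitDecided s u) (residual G u)
    step-decided {u} sym-s u∉V? = residual-undecidedOutside
      (⊑-trans (deleteVs-⊑ (isEq u) t) (⊑-trans (deleteVs-⊑ _ _) (addUndV-⊑ _ _))) adm
      (deleteVs-self u t) H⊆s′ marked
      where
        open Symmetric sym-s
        t : State
        t = deleteVs (decidedNbr s u) (addUndV (undecidedNbr s u) s)

        u∉XV : XV u ≡ false
        u∉XV = ⇒-false XV⊆undV u∉V?

        H⊆s′ : ∀ {w} → vertices (residual G u) w ≡ true → curV (visitDecided s u) w ≡ true
        H⊆s′ {w} w∈H =
          ∧-intro (∧-intro w∈s (cong not (⇒-∧-not nbr⇒undecided))) (cong not (trans (isEq-sym u w) w≢u))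
          where
            w∈G : vertices G w ≡ true
            w∈G = proj₁ (residual-vertex G u w∈H)
            w≢u : isEq w u ≡ false
            w≢u = proj₁ (proj₂ (residual-vertex G u w∈H))
            not-adjacent : vertices G u ∧ edges G w u ≡ false
            not-adjacent = proj₂ (proj₂ (residual-vertex G u w∈H))
            w∈s : curV s w ≡ true
            w∈s = proj₁ (G-vertex w∈G)
            w∉XV : XV w ≡ false
            w∉XV = proj₂ (G-vertex w∈G)
            -- u ∈ G ∖ X and w survived it, so the edge wu was deleted, and only XE can do that.
            nbr⇒undecided : nbr s u w ≡ true → undE s u w ≡ true
            nbr⇒undecided uw∈s = trans (undE-sym u w) (XE⊆undE (∧-not³≡false wu∈s w∉XV u∉XV wu∉G))
              where
                u∈s : curV s u ≡ true
                u∈s = proj₁ (∧≡true uw∈s)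
                wu∈s : curE s w u ≡ true
                wu∈s = trans (curE-sym w u) (proj₂ (∧≡true (proj₂ (∧≡true {curV s u} uw∈s))))
                wu∉G : edges G w u ≡ false
                wu∉G = trans (cong (_∧ edges G w u) (sym (∧-intro u∈s (cong not u∉XV)))) not-adjacent

        marked : ∀ {w} → curV (visitDecided s u) w ≡ true → vertices G u ≡ true → edges G w u ≡ true
               → undV (visitDecided s u) w ≡ true
        marked {w} w∈s′ u∈G wu∈G = _⊑_.undV-kept (deleteVs-⊑ (isEq u) t) w∈s′
          (addUndV-marks (decidedNbr s u) (undecidedNbr s u) s w∈t
                         (∧-intro uw∈s (∧-not-excluded uw∈s not-dropped)))
          where
            w∈t : curV t w ≡ true
            w∈t = proj₁ (∧-not≡true w∈s′)
            not-dropped : decidedNbr s u w ≡ false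
            not-dropped = proj₂ (∧-not≡true w∈t)
            uw∈s : nbr s u w ≡ true
            uw∈s = nbr-intro s (proj₁ (G-vertex u∈G)) (proj₁ (∧-not≡true w∈t))
                     (trans (curE-sym u w) (proj₁ (∧≡true wu∈G)))

  module _ (s : State {n}) (u : Fin n) (us : List (Fin n)) (running : bothEmpty s ≡ false) where

    F-absent : curV s u ≡ false → F (u ∷ us) s ≡ F us s
    F-absent u∉s rewrite running | u∉s = refl

    F-undecided : curV s u ≡ true → undV s u ≡ true → F (u ∷ us) s ≡ ⁅ u ⁆ ∪ F us (visitUndecided s u)
    F-undecided u∈s u∈V? rewrite running | u∈s | u∈V? = refl

    F-decided : curV s u ≡ true → undV s u ≡ false → F (u ∷ us) s ≡ F us (visitDecided s u)
    F-decided u∈s u∉V? rewrite running | u∈s | u∉V? = refl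

  lfmis-∷-agree : {s : State} (s′ : State) {u : Fin n} (us : List (Fin n)) {o : Fin n}
                  {XV₁ XV₂ : VSet n} {XE₁ XE₂ : ESet n}
    → (∀ {XV XE} → Admissible s XV XE → UndecidedOutside s′ (residual (graphOf s ∖[ XV , XE ]) u))
    → Admissible s XV₁ XE₁ → Admissible s XV₂ XE₂
    → vertices (graphOf s ∖[ XV₁ , XE₁ ]) u ∧ isEq o u
      ≡ vertices (graphOf s ∖[ XV₂ , XE₂ ]) u ∧ isEq o u
    → (∀ {XV₁′ XE₁′ XV₂′ XE₂′} → Admissible s′ XV₁′ XE₁′ → Admissible s′ XV₂′ XE₂′
       → lfmis us (graphOf s′ ∖[ XV₁′ , XE₁′ ]) o
         ≡ lfmis us (graphOf s′ ∖[ XV₂′ , XE₂′ ]) o)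
    → lfmis (u ∷ us) (graphOf s ∖[ XV₁ , XE₁ ]) o ≡ lfmis (u ∷ us) (graphOf s ∖[ XV₂ , XE₂ ]) o
  lfmis-∷-agree {s} s′ {u} us {o} {XV₁} {XV₂} {XE₁} {XE₂} tracked adm₁ adm₂ head-≡ tail-≡
    with undecidedOutside⇒deletion (tracked adm₁) | undecidedOutside⇒deletion (tracked adm₂)
  ... | _ , _ , adm₁′ , H₁≈ | _ , _ , adm₂′ , H₂≈ = begin
    lfmis (u ∷ us) G₁ o                                     ≡⟨ lfmis-∷ G₁ u us o ⟩
    (vertices G₁ u ∧ isEq o u) ∨ lfmis us (residual G₁ u) o ≡⟨ cong₂ _∨_ head-≡ residual-≡ ⟩
    (vertices G₂ u ∧ isEq o u) ∨ lfmis us (residual G₂ u) o ≡⟨ lfmis-∷ G₂ u us o ⟨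
    lfmis (u ∷ us) G₂ o                                     ∎
    where
      open ≡-Reasoning
      G₁ G₂ : Graph
      G₁ = graphOf s ∖[ XV₁ , XE₁ ]
      G₂ = graphOf s ∖[ XV₂ , XE₂ ]
      residual-≡ : lfmis us (residual G₁ u) o ≡ lfmis us (residual G₂ u) o
      residual-≡ =
        trans (lfmis-cong H₁≈ us o) (trans (tail-≡ adm₁′ adm₂′) (sym (lfmis-cong H₂≈ us o)))

  F-conservative : (us : List (Fin n)) {s : State} → Symmetric s
    → ∀ {XV₁ XE₁ XV₂ XE₂} → Admissible s XV₁ XE₁ → Admissible s XV₂ XE₂
    → ∀ {o} → F us s o ≡ false
    → lfmis us (graphOf s ∖[ XV₁ , XE₁ ]) o ≡ lfmis us (graphOf s ∖[ XV₂ , XE₂ ]) o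
  F-conservative []       _ _ _ _ = refl
  F-conservative (u ∷ us) {s} sym-s {XV₁} {XE₁} {XV₂} {XE₂} adm₁ adm₂ {o} o∉F =
    byCase (bothEmpty s) (curV s u) (undV s u) refl refl refl
    where
      G₁ G₂ : Graph
      G₁ = graphOf s ∖[ XV₁ , XE₁ ]
      G₂ = graphOf s ∖[ XV₂ , XE₂ ]

      recurse : (s′ : State) → Symmetric s′ → F us s′ o ≡ false
        → ∀ {XV₁′ XE₁′ XV₂′ XE₂′} → Admissible s′ XV₁′ XE₁′ → Admissible s′ XV₂′ XE₂′
        → lfmis us (graphOf s′ ∖[ XV₁′ , XE₁′ ]) o ≡ lfmis us (graphOf s′ ∖[ XV₂′ , XE₂′ ]) o
      recurse s′ sym′ o∉F′ adm₁′ adm₂′ = F-conservative us {s′} sym′ adm₁′ adm₂′ {o} o∉F′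

      -- Equations instead of `with`, for the same reason as in lfmis-∷.
      byCase : ∀ b p q → bothEmpty s ≡ b → curV s u ≡ p → undV s u ≡ q
             → lfmis (u ∷ us) G₁ o ≡ lfmis (u ∷ us) G₂ o
      byCase true _ _ done _ _ = trans (lfmis-cong (bothEmpty-∖ done adm₁) (u ∷ us) o)
                                       (sym (lfmis-cong (bothEmpty-∖ done adm₂) (u ∷ us) o))
      byCase false false _ running u∉s _ =
        lfmis-∷-agree s us (λ adm → step-absent adm u∉s) adm₁ adm₂
          (cong (_∧ isEq o u) (trans (u∉G XV₁) (sym (u∉G XV₂))))
          (recurse s sym-s (trans (cong-app (sym (F-absent s u us running u∉s)) o) o∉F))
        where
          u∉G : (XV : VSet n) → curV s u ∧ not (XV u) ≡ false
          u∉G XV = cong (_∧ not (XV u)) u∉s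
      byCase false true true running u∈s u∈V? =
        lfmis-∷-agree (visitUndecided s u) us (λ adm → step-undecided adm sym-s) adm₁ adm₂
          (∧-same-false (vertices G₁ u) (vertices G₂ u) o≢u)
          (recurse (visitUndecided s u) sym′ (∨-conicalʳ _ _ o∉F′))
        where
          o∉F′ : isEq o u ∨ F us (visitUndecided s u) o ≡ false
          o∉F′ = trans (cong-app (sym (F-undecided s u us running u∈s u∈V?)) o) o∉F
          o≢u : isEq o u ≡ false
          o≢u = ∨-conicalˡ _ _ o∉F′
          sym′ : Symmetric (visitUndecided s u)
          sym′ = deleteVs-symmetric (isEq u) (addUndV-symmetric (nbr s u) sym-s)
      byCase false true false running u∈s u∉V? =
        lfmis-∷-agree (visitDecided s u) us (λ adm → step-decided adm sym-s u∉V?) adm₁ adm₂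
          (cong (_∧ isEq o u) (trans (u∈G adm₁) (sym (u∈G adm₂))))
          (recurse (visitDecided s u) sym′
                   (trans (cong-app (sym (F-decided s u us running u∈s u∉V?)) o) o∉F))
        where
          u∈G : ∀ {XV XE} → Admissible s XV XE → curV s u ∧ not (XV u) ≡ curV s u
          u∈G adm = trans (cong (λ x → curV s u ∧ not x) (⇒-false (Admissible.XV⊆undV adm) u∉V?))
                          (∧-identityʳ (curV s u))
          sym′ : Symmetric (visitDecided s u)
          sym′ = deleteVs-symmetric (isEq u) (deleteVs-symmetric (decidedNbr s u)
                   (addUndV-symmetric (undecidedNbr s u) sym-s))

mainTheorem5 : {n : ℕ} (adj : ESet n)
    → (∀ u v → adj u v ≡ adj v u) → (∀ u → adj u u ≡ false)
    → (π : Permutation′ n) (Vq : VSet n) (Eq : ESet n)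
    → (∀ u v → Eq u v ≡ Eq v u) → (∀ u v → Eq u v ≡ true → adj u v ≡ true)
    → (o : Fin n)
    → (XV : VSet n) (XE : ESet n)
    → (∀ v → XV v ≡ true → Vq v ≡ true)
    → (∀ u v → XE u v ≡ XE v u)
    → (∀ u v → XE u v ≡ true → Eq u v ≡ true)
    → (M π (λ _ → true) adj o xor M π (delV XV) (delE adj XV XE) o) ≡ true
    → InfluenceMIS π adj Vq Eq o ≡ true
mainTheorem5 {n} adj adj-sym _ π Vq Eq Eq-sym _ o XV XE XV⊆Vq _ XE⊆Eq o∈M△M′ =
  ¬-not λ o∉S → xor-≢ o∈M△M′ (begin
    M π (λ _ → true) adj o
      ≡⟨ lfmis-cong (∖-trivial G (λ _ → refl) (λ _ _ → refl)) (order π) o ⟨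
    lfmis (order π) (G ∖[ ∅ , (λ _ _ → false) ]) o
      ≡⟨ F-conservative (order π) symmetric nothing-deleted X-admissible o∉S ⟩
    M π (delV XV) (delE adj XV XE) o ∎)
  where
    open ≡-Reasoning
    G : Graph
    G = graph (λ _ → true) adj
    s₀ : State
    s₀ = st (λ _ → true) adj Vq Eq
    symmetric : Symmetric s₀
    symmetric = record { curE-sym = adj-sym ; undE-sym = Eq-sym }
    nothing-deleted : Admissible s₀ ∅ (λ _ _ → false)
    nothing-deleted = record { XV⊆undV = λ () ; XE⊆undE = λ () }
    X-admissible : Admissible s₀ XV XE
    X-admissible = record { XV⊆undV = XV⊆Vq _ ; XE⊆undE = XE⊆Eq _ _ }
    xor-≢ : ∀ {a b} → a xor b ≡ true → a ≢ b
    xor-≢ {b = b} a⊕b a≡b =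
      contradiction (trans (sym a⊕b) (trans (cong (_xor b) a≡b) (xor-same b))) λ ()
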